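{- Let $k>r\ge2$ and let $G$ be an $r$-uniform hypergraph on $k$ vertices with at least one edge, not isomorphic to $K^{(r)}_k$ and not isomorphic to $S^{(r)}_k$. Then there exists a subgraph $G'$ of $G$ with \[ |E(G')|>\frac{\binom{k-1}{r-1}-1}{\binom{k-1}{r-1}}|E(G)|\quad\text{and}\quad \Delta(G')\le\binom{k-1}{r-1}-1. \]
   Context: $K^{(r)}_k$ is the complete $r$-graph on $k$ vertices; $S^{(r)}_k$ is the $k$-vertex $r$-graph whose edges are all $r$-subsets containing a fixed vertex. $\Delta(\cdot)$ is the maximum degree (degree = number of edges containing a vertex). -}

module Defs where

open import Data.Nat using (ℕ; _⊔_)
open import Data.Fin using (Fin; zero)
open import Data.Fin.Subset using (Subset; ∣_∣; _∈_)
open import Data.Fin.Subset.Properties using (_∈?_)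
open import Data.Fin.Permutation using (Permutation′; _⟨$⟩ˡ_)
open import Data.Vec using (tabulate; lookup)
open import Data.List using (List; length; filter; map; foldr; allFin)
open import Data.List.Relation.Unary.All using (All)
open import Data.List.Relation.Unary.Unique.Propositional using (Unique)
import Data.List.Membership.Propositional as L
open import Data.Product using (Σ; _×_)
open import Function.Bundles using (_⇔_)
open import Relation.Binary.PropositionalEquality using (_≡_)

record Hypergraph (k r : ℕ) : Set where
  field
    E       : List (Subset k)
    unique  : Unique E
    uniform : All (λ e → ∣ e ∣ ≡ r) E
open Hypergraph public

numEdges : ∀ {k r} → Hypergraph k r → ℕ
numEdges G = length (E G)

deg : ∀ {k r} → Hypergraph k r → Fin k → ℕ
deg G v = length (filter (v ∈?_) (E G))

Δ : ∀ {k r} → Hypergraph k r → ℕ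
Δ {k} G = foldr _⊔_ 0 (map (deg G) (allFin k))

_⊑_ : ∀ {k r} → Hypergraph k r → Hypergraph k r → Set
G' ⊑ G = ∀ e → e L.∈ E G' → e L.∈ E G

-- image of a vertex subset under a permutation π of the vertices:
-- i ∈ image π e  iff  π⁻¹ i ∈ e
image : ∀ {k} → Permutation′ k → Subset k → Subset k
image π e = tabulate (λ i → lookup e (π ⟨$⟩ˡ i))

IsoTo : ∀ {k r} → Hypergraph k r → (Subset k → Set) → Set
IsoTo {k} G P = Σ (Permutation′ k) (λ π → ∀ e → (e L.∈ E G) ⇔ P (image π e))

KEdge : (k r : ℕ) → Subset k → Set
KEdge k r s = ∣ s ∣ ≡ r

SEdge : ∀ {k} (r : ℕ) → Fin k → Subset k → Set
SEdge r c s = ∣ s ∣ ≡ r × (c ∈ s)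

module Submission where

-- D is the number of r-sets through a vertex, so every degree is at most D; call
-- the vertices of degree exactly D full, and let F be their set.  Every r-set
-- through a full vertex is an edge.  Cover F greedily by m r-sets, r·m ≤ |F| + r - 1,
-- and delete them: every full vertex loses an edge, so Δ(G') ≤ D - 1, and the edge
-- bound holds as soon as D·m < |E(G)|.  If F is empty, m = 0.  If fewer than r
-- vertices are not full, every r-set meets F and G is complete.  If |F| = 1, then
-- m = 1, and since G is not a star some edge avoids the full vertex: |E(G)| > D.
-- If |F| ≥ 2, |E(G)| is at least the number C(k,r) - C(k-|F|,r) of r-sets meeting F,
-- which exceeds D·m by a binomial estimate (cover-count).

open import Defs
open import Data.Nat using (ℕ; zero; suc; _+_; _*_; _∸_; _≤_; _<_; _≤′_; ≤′-refl; ≤′-step; z≤n; s≤s; _≟_; _≤?_; _<?_)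
open import Data.Nat.Properties
open import Data.Nat.Combinatorics using (_C_; nCk+nC[k+1]≡[n+1]C[k+1])
open import Data.Nat.Combinatorics.Specification using (k>n⇒nCk≡0)
open import Data.Nat.Tactic.RingSolver using (solve-∀)
import Data.Bool as Bool
open import Data.Fin using (Fin; zero; suc)
open import Data.Fin.Subset using (Subset; inside; outside; ∣_∣; ∁; _─_; _⊆_; Nonempty; ⁅_⁆)
  renaming (_∈_ to _∈ₛ_; ⊥ to ∅)
open import Data.Fin.Subset.Properties using (_∈?_; ∣p∣≤n; ∣⊥∣≡0; ⊥⊆; ∣∁p∣≡n∸∣p∣; ∣⁅x⁆∣≡1; x∈⁅x⁆; drop-there)
open import Data.Vec using ([]; _∷_; tabulate)
open import Data.Vec.Properties using (≡-dec; ∷-injectiveʳ; lookup∘tabulate; []=⇒lookup; lookup⇒[]=; tabulate∘lookup)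
open import Data.Vec.Base using (here; there)
open import Data.List using (List; []; _∷_; _++_; [_]; map; length; filter; allFin)
open import Data.List.Properties using (length-++; length-map; foldr-preservesᵇ)
open import Data.List.Membership.Propositional using (_∈_; _∉_; find; lose)
import Data.List.Membership.DecPropositional as DecMembership
open import Data.List.Membership.Propositional.Properties using (∈-filter⁺; ∈-filter⁻; ∈-∃++; ∈-++⁻; ∈-++⁺ˡ; ∈-++⁺ʳ; ∈-map⁺; ∈-map⁻)
open import Data.List.Relation.Unary.Any using (Any; here; there; any?)
open import Data.List.Relation.Unary.All using (All; []; _∷_)
import Data.List.Relation.Unary.All as All
open import Data.List.Relation.Unary.Unique.Propositional using (Unique)
open import Data.List.Relation.Unary.Unique.Propositional.Properties using (map⁺; ++⁺; filter⁺)
import Data.List.Relation.Unary.All.Properties as All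
open import Data.List.Relation.Unary.AllPairs using ([]; _∷_)
open import Data.Product using (Σ; _×_; _,_; proj₁; proj₂)
open import Data.Sum using (_⊎_; inj₁; inj₂)
open import Data.Empty using (⊥-elim)
open import Relation.Nullary using (¬_; Dec; yes; no; does; ¬?)
open import Relation.Binary.Definitions using (DecidableEquality)
open import Relation.Nullary.Decidable using (dec-true)
open import Function.Bundles using (_⇔_; mk⇔)
import Data.Fin.Permutation as Permutation
open import Relation.Binary.PropositionalEquality hiding ([_])

-- Binomial coefficients by Pascal's rule.  This recursion matches the
-- recursive enumeration of subsets below; binom≡C transfers to stdlib's _C_.
binom : ℕ → ℕ → ℕ
binom n       zero    = 1
binom zero    (suc j) = 0
binom (suc n) (suc j) = binom n j + binom n (suc j)

binom≡C : ∀ n j → binom n j ≡ n C j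
binom≡C n       zero    = refl
binom≡C zero    (suc j) = sym (k>n⇒nCk≡0 {0} {suc j} (s≤s z≤n))
binom≡C (suc n) (suc j) =
  trans (cong₂ _+_ (binom≡C n j) (binom≡C n (suc j))) (nCk+nC[k+1]≡[n+1]C[k+1] n j)

binom-pos : ∀ {n j} → j ≤ n → 0 < binom n j
binom-pos {n}     {zero}  _         = s≤s z≤n
binom-pos {suc n} {suc j} (s≤s j≤n) = ≤-trans (binom-pos j≤n) (m≤m+n _ _)

binom-1 : ∀ n → binom n 1 ≡ n
binom-1 zero    = refl
binom-1 (suc n) = cong suc (binom-1 n)

binom-absorb : ∀ n j → suc j * binom (suc n) (suc j) ≡ suc n * binom n j
binom-absorb zero    zero    = refl
binom-absorb zero    (suc j) = *-zeroʳ (suc (suc j))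
binom-absorb (suc n) zero    = trans (+-identityʳ _) (trans (binom-1 (suc (suc n))) (sym (*-identityʳ _)))
binom-absorb (suc n) (suc j) = begin
    suc (suc j) * (binom (suc n) (suc j) + binom (suc n) (suc (suc j)))
      ≡⟨ *-distribˡ-+ (suc (suc j)) (binom (suc n) (suc j)) _ ⟩
    (binom (suc n) (suc j) + suc j * binom (suc n) (suc j)) + suc (suc j) * binom (suc n) (suc (suc j))
      ≡⟨ cong₂ (λ x y → (binom (suc n) (suc j) + x) + y) (binom-absorb n j) (binom-absorb n (suc j)) ⟩
    (binom (suc n) (suc j) + suc n * binom n j) + suc n * binom n (suc j)
      ≡⟨ regroup (binom (suc n) (suc j)) (binom n j) (binom n (suc j)) n ⟩
    suc (suc n) * binom (suc n) (suc j) ∎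
  where
  open ≡-Reasoning
  regroup : ∀ x y z n → (x + suc n * y) + suc n * z ≡ x + suc n * (y + z)
  regroup = solve-∀

-- Its companion  (j+1)·C(n,j+1) + j·C(n,j) = n·C(n,j),  i.e. (j+1)·C(n,j+1) = (n-j)·C(n,j).
binom-shift : ∀ n j → suc j * binom n (suc j) + j * binom n j ≡ n * binom n j
binom-shift zero    zero    = refl
binom-shift zero    (suc j) = cong₂ _+_ (*-zeroʳ (suc (suc j))) (*-zeroʳ (suc j))
binom-shift (suc n) zero    = trans (+-identityʳ _) (binom-absorb n zero)
binom-shift (suc n) (suc j) = begin
    suc (suc j) * binom (suc n) (suc (suc j)) + suc j * binom (suc n) (suc j)
      ≡⟨ cong₂ _+_ (binom-absorb n (suc j)) (binom-absorb n j) ⟩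
    suc n * binom n (suc j) + suc n * binom n j
      ≡⟨ sym (*-distribˡ-+ (suc n) (binom n (suc j)) (binom n j)) ⟩
    suc n * (binom n (suc j) + binom n j)
      ≡⟨ cong (suc n *_) (+-comm (binom n (suc j)) (binom n j)) ⟩
    suc n * binom (suc n) (suc j) ∎
  where open ≡-Reasoning

binom-mono : ∀ {m n} j → m ≤ n → binom m j ≤ binom n j
binom-mono j m≤n = go (≤⇒≤′ m≤n)
  where
  step : ∀ n j → binom n j ≤ binom (suc n) j
  step n zero    = ≤-refl
  step n (suc j) = m≤n+m (binom n (suc j)) (binom n j)
  go : ∀ {m n} → m ≤′ n → binom m j ≤ binom n j
  go ≤′-refl       = ≤-refl
  go (≤′-step m≤n) = ≤-trans (go m≤n) (step _ j)

binom-strict : ∀ {m n j} → 1 ≤ j → j ≤ suc m → m < n → binom m j < binom n j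
binom-strict {m} {n} {suc j} _ (s≤s j≤m) m<n =
  <-≤-trans (+-monoˡ-< (binom m (suc j)) (binom-pos j≤m)) (binom-mono (suc j) m<n)

key-inequality : ∀ b t g {D X} → X < D
  → (suc g + b) * D + (suc b + t) * X < suc ((suc b + t) + g) * D + b * X
key-inequality b t g {D} {X} X<D = begin-strict
    (suc g + b) * D + (suc b + t) * X   ≡⟨ split-lhs (suc g) b t D X ⟩
    ((suc g + b) * D + b * X) + suc t * X
      <⟨ +-monoʳ-< ((suc g + b) * D + b * X) (*-monoʳ-< (suc t) X<D) ⟩
    ((suc g + b) * D + b * X) + suc t * D ≡⟨ split-rhs g b t D X ⟩
    suc ((suc b + t) + g) * D + b * X   ∎
  where
  open ≤-Reasoning
  split-lhs : ∀ f b t D X → (f + b) * D + (suc b + t) * X ≡ ((f + b) * D + b * X) + suc t * X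
  split-lhs = solve-∀
  split-rhs : ∀ g b t D X → ((suc g + b) * D + b * X) + suc t * D ≡ suc ((suc b + t) + g) * D + b * X
  split-rhs = solve-∀

-- The counting inequality behind the case |F| ≥ 2.  Let F be a set of f = g+1 ≥ 2
-- vertices in a (n+g+1)-vertex set, with r = b+1 ≤ n, and let N be the number of
-- r-sets meeting F, so N + C(n,r) = C(n+g+1,r).
cover-count : ∀ {n g b N m} → 1 ≤ b → b < n → 1 ≤ g
  → N + binom n (suc b) ≡ binom (suc (n + g)) (suc b)
  → suc b * m ≤ suc g + b
  → binom (n + g) b * m < N
cover-count {n} {g} {b} {N} {m} 1≤b b<n 1≤g count few-sets =
  *-cancelˡ-< (suc b) _ _ (≤-<-trans rDm≤ (+-cancelʳ-< (n * X) _ _ core))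
  where
  D = binom (n + g) b
  X = binom n b
  R = binom n (suc b)
  X<D : X < D
  X<D = binom-strict 1≤b (≤-trans (<⇒≤ b<n) (n≤1+n n))
          (≤-trans (≤-reflexive (+-comm 1 n)) (+-monoʳ-≤ n 1≤g))
  rDm≤ : suc b * (D * m) ≤ (suc g + b) * D
  rDm≤ = begin
      suc b * (D * m) ≡⟨ reorder (suc b) D m ⟩
      (suc b * m) * D ≤⟨ *-monoˡ-≤ D few-sets ⟩
      (suc g + b) * D ∎
    where
    open ≤-Reasoning
    reorder : ∀ x y z → x * (y * z) ≡ (x * z) * y
    reorder = solve-∀
  rN+rR : suc b * N + suc b * R ≡ suc (n + g) * D
  rN+rR = trans (sym (*-distribˡ-+ (suc b) N R)) (trans (cong (suc b *_) count) (binom-absorb (n + g) b))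
  core : (suc g + b) * D + n * X < suc b * N + n * X
  core with t , refl ← m≤n⇒∃[o]m+o≡n b<n = begin-strict
      (suc g + b) * D + (suc b + t) * X      <⟨ key-inequality b t g X<D ⟩
      suc ((suc b + t) + g) * D + b * X      ≡⟨ cong (_+ b * X) (sym rN+rR) ⟩
      (suc b * N + suc b * R) + b * X        ≡⟨ +-assoc (suc b * N) _ _ ⟩
      suc b * N + (suc b * R + b * X)        ≡⟨ cong (suc b * N +_) (binom-shift (suc b + t) b) ⟩
      suc b * N + (suc b + t) * X            ∎
    where open ≤-Reasoning

unique-length-≤ : ∀ {A : Set} {xs ys : List A} → Unique xs → (∀ {x} → x ∈ xs → x ∈ ys) → length xs ≤ length ys
unique-length-≤ {xs = []}     _          _   = z≤n
unique-length-≤ {xs = x ∷ xs} (x∉ ∷ uniq) xs⊆ys with as , bs , refl ← ∈-∃++ (xs⊆ys (here refl)) =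
  subst (suc (length xs) ≤_) (sym length-with-x) (s≤s (unique-length-≤ uniq xs⊆as++bs))
  where
  length-with-x : length (as ++ [ x ] ++ bs) ≡ suc (length (as ++ bs))
  length-with-x = trans (length-++ as) (trans (+-suc (length as) (length bs)) (cong suc (sym (length-++ as))))
  xs⊆as++bs : ∀ {y} → y ∈ xs → y ∈ as ++ bs
  xs⊆as++bs y∈xs with ∈-++⁻ as (xs⊆ys (there y∈xs))
  ... | inj₁ y∈as          = ∈-++⁺ˡ y∈as
  ... | inj₂ (here refl)   = ⊥-elim (All.lookup x∉ y∈xs refl)
  ... | inj₂ (there y∈bs) = ∈-++⁺ʳ as y∈bs

∣∁p∣+∣p∣≡n : ∀ {n} (p : Subset n) → ∣ ∁ p ∣ + ∣ p ∣ ≡ n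
∣∁p∣+∣p∣≡n p = trans (cong (_+ ∣ p ∣) (∣∁p∣≡n∸∣p∣ p)) (m∸n+n≡m (∣p∣≤n p))

member⇒size≥1 : ∀ {n} {p : Subset n} {v} → v ∈ₛ p → 1 ≤ ∣ p ∣
member⇒size≥1 {p = inside  ∷ p} _         = s≤s z≤n
member⇒size≥1 {p = outside ∷ p} (there q) = member⇒size≥1 q

size≥1⇒nonempty : ∀ {n} (p : Subset n) → 1 ≤ ∣ p ∣ → Nonempty p
size≥1⇒nonempty (inside  ∷ p) _ = zero , here
size≥1⇒nonempty (outside ∷ p) q with v , v∈p ← size≥1⇒nonempty p q = suc v , there v∈p

subset-of-size : ∀ {n} (F : Subset n) j → j ≤ ∣ F ∣ → Σ (Subset n) (λ T → T ⊆ F × ∣ T ∣ ≡ j)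
subset-of-size {n} F zero _ = ∅ , ⊥⊆ , ∣⊥∣≡0 n
subset-of-size (inside ∷ F) (suc j) (s≤s j≤∣F∣) with T , T⊆F , ∣T∣ ← subset-of-size F j j≤∣F∣ =
  inside ∷ T , (λ { here → here ; (there p) → there (T⊆F p) }) , cong suc ∣T∣
subset-of-size (outside ∷ F) (suc j) j≤∣F∣ with T , T⊆F , ∣T∣ ← subset-of-size F (suc j) j≤∣F∣ =
  outside ∷ T , (λ { (there p) → there (T⊆F p) }) , ∣T∣

superset-of-size : ∀ {n} (T : Subset n) j → ∣ T ∣ ≤ j → j ≤ n → Σ (Subset n) (λ s → ∣ s ∣ ≡ j × T ⊆ s)
superset-of-size []           zero    _         _         = [] , refl , λ ()
superset-of-size (inside ∷ T) (suc j) (s≤s ∣T∣≤j) (s≤s j≤n)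
  with s , ∣s∣ , T⊆s ← superset-of-size T j ∣T∣≤j j≤n =
  inside ∷ s , cong suc ∣s∣ , λ { here → here ; (there p) → there (T⊆s p) }
superset-of-size {suc n} (outside ∷ T) j ∣T∣≤j j≤1+n with j ≤? n
... | yes j≤n with s , ∣s∣ , T⊆s ← superset-of-size T j ∣T∣≤j j≤n =
  outside ∷ s , ∣s∣ , λ { (there p) → there (T⊆s p) }
superset-of-size {suc n} (outside ∷ T) (suc j) ∣T∣≤j (s≤s j≤n) | no j≰n
  with s , ∣s∣ , T⊆s ← superset-of-size T j (≤-trans (∣p∣≤n T) (≤-pred (≰⇒> j≰n))) j≤n =
  inside ∷ s , cong suc ∣s∣ , λ { (there p) → there (T⊆s p) }
superset-of-size {suc n} (outside ∷ T) zero _ _ | no j≰n = ⊥-elim (j≰n z≤n)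

∣F─T∣+∣T∣≡∣F∣ : ∀ {n} (F T : Subset n) → T ⊆ F → ∣ F ─ T ∣ + ∣ T ∣ ≡ ∣ F ∣
∣F─T∣+∣T∣≡∣F∣ []            []            _   = refl
∣F─T∣+∣T∣≡∣F∣ (inside  ∷ F) (inside  ∷ T) T⊆F =
  trans (+-suc _ _) (cong suc (∣F─T∣+∣T∣≡∣F∣ F T (λ p → drop-there (T⊆F (there p)))))
∣F─T∣+∣T∣≡∣F∣ (inside  ∷ F) (outside ∷ T) T⊆F = cong suc (∣F─T∣+∣T∣≡∣F∣ F T (λ p → drop-there (T⊆F (there p))))
∣F─T∣+∣T∣≡∣F∣ (outside ∷ F) (inside  ∷ T) T⊆F with () ← T⊆F here
∣F─T∣+∣T∣≡∣F∣ (outside ∷ F) (outside ∷ T) T⊆F = ∣F─T∣+∣T∣≡∣F∣ F T (λ p → drop-there (T⊆F (there p)))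

∈-─-split : ∀ {n} (F T : Subset n) {v} → v ∈ₛ F → v ∈ₛ T ⊎ v ∈ₛ F ─ T
∈-─-split (inside ∷ F) (inside  ∷ T) here = inj₁ here
∈-─-split (inside ∷ F) (outside ∷ T) here = inj₂ here
∈-─-split (_ ∷ F)      (_ ∷ T)       (there p) with ∈-─-split F T p
... | inj₁ q = inj₁ (there q)
... | inj₂ q = inj₂ (there q)

Meets : ∀ {n} → Subset n → Subset n → Set
Meets F s = Σ (Fin _) (λ v → v ∈ₛ F × v ∈ₛ s)

meets-there : ∀ {n} {F s : Subset n} {x y} → Meets F s → Meets (x ∷ F) (y ∷ s)
meets-there (v , v∈F , v∈s) = suc v , there v∈F , there v∈s

large⇒meets : ∀ {n} (F s : Subset n) → ∣ ∁ F ∣ < ∣ s ∣ → Meets F s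
large⇒meets (inside  ∷ F) (inside  ∷ s) _         = zero , here , here
large⇒meets (inside  ∷ F) (outside ∷ s) lt        = meets-there (large⇒meets F s lt)
large⇒meets (outside ∷ F) (inside  ∷ s) (s≤s lt) = meets-there (large⇒meets F s lt)
large⇒meets (outside ∷ F) (outside ∷ s) lt        = meets-there (large⇒meets F s (≤-trans (n≤1+n _) lt))

branch : ∀ {n} → List (Subset n) → List (Subset n) → List (Subset (suc n))
branch xs ys = map (inside ∷_) xs ++ map (outside ∷_) ys

branch-length : ∀ {n} (xs ys : List (Subset n)) → length (branch xs ys) ≡ length xs + length ys
branch-length xs ys = trans (length-++ (map (inside ∷_) xs)) (cong₂ _+_ (length-map _ xs) (length-map _ ys))

branch-unique : ∀ {n} {xs ys : List (Subset n)} → Unique xs → Unique ys → Unique (branch xs ys)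
branch-unique ux uy = ++⁺ (map⁺ ∷-injectiveʳ ux) (map⁺ ∷-injectiveʳ uy) disjoint
  where
  disjoint : ∀ {s} → ¬ (s ∈ map (inside ∷_) _ × s ∈ map (outside ∷_) _)
  disjoint (p , q) with ∈-map⁻ (inside ∷_) p | ∈-map⁻ (outside ∷_) q
  ... | _ , _ , refl | _ , _ , ()

branch-inside : ∀ {n} {xs ys : List (Subset n)} {s} → s ∈ xs → inside ∷ s ∈ branch xs ys
branch-inside s∈xs = ∈-++⁺ˡ (∈-map⁺ (inside ∷_) s∈xs)

branch-outside : ∀ {n} {xs ys : List (Subset n)} {s} → s ∈ ys → outside ∷ s ∈ branch xs ys
branch-outside {xs = xs} s∈ys = ∈-++⁺ʳ (map (inside ∷_) xs) (∈-map⁺ (outside ∷_) s∈ys)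

branch-cases : ∀ {n} {xs ys : List (Subset n)} {t} → t ∈ branch xs ys
  → (Σ (Subset n) λ s → t ≡ inside ∷ s × s ∈ xs) ⊎ (Σ (Subset n) λ s → t ≡ outside ∷ s × s ∈ ys)
branch-cases {xs = xs} t∈ with ∈-++⁻ (map (inside ∷_) xs) t∈
... | inj₁ p with s , s∈ , eq ← ∈-map⁻ (inside ∷_) p  = inj₁ (s , eq , s∈)
... | inj₂ p with s , s∈ , eq ← ∈-map⁻ (outside ∷_) p = inj₂ (s , eq , s∈)

subsets : (n j : ℕ) → List (Subset n)
subsets zero    zero    = [ [] ]
subsets zero    (suc j) = []
subsets (suc n) zero    = branch [] (subsets n zero)
subsets (suc n) (suc j) = branch (subsets n j) (subsets n (suc j))

subsets-unique : ∀ n j → Unique (subsets n j)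
subsets-unique zero    zero    = [] ∷ []
subsets-unique zero    (suc j) = []
subsets-unique (suc n) zero    = branch-unique [] (subsets-unique n zero)
subsets-unique (suc n) (suc j) = branch-unique (subsets-unique n j) (subsets-unique n (suc j))

subsets-length : ∀ n j → length (subsets n j) ≡ binom n j
subsets-length zero    zero    = refl
subsets-length zero    (suc j) = refl
subsets-length (suc n) zero    = trans (branch-length [] (subsets n zero)) (subsets-length n zero)
subsets-length (suc n) (suc j) =
  trans (branch-length (subsets n j) _) (cong₂ _+_ (subsets-length n j) (subsets-length n (suc j)))

subsets-sound : ∀ {n j s} → s ∈ subsets n j → ∣ s ∣ ≡ j
subsets-sound {zero}  {zero}  (here refl) = refl
subsets-sound {suc n} {zero}  p with branch-cases {xs = []} p
... | inj₂ (s , refl , s∈) = subsets-sound s∈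
subsets-sound {suc n} {suc j} p with branch-cases {xs = subsets n j} p
... | inj₁ (s , refl , s∈) = cong suc (subsets-sound s∈)
... | inj₂ (s , refl , s∈) = subsets-sound s∈

subsets-complete : ∀ {n j} (s : Subset n) → ∣ s ∣ ≡ j → s ∈ subsets n j
subsets-complete {j = zero}  []            refl  = here refl
subsets-complete {j = suc j} (inside  ∷ s) ∣s∣ = branch-inside (subsets-complete s (suc-injective ∣s∣))
subsets-complete {j = zero}  (outside ∷ s) ∣s∣ = branch-outside (subsets-complete s ∣s∣)
subsets-complete {j = suc j} (outside ∷ s) ∣s∣ = branch-outside (subsets-complete s ∣s∣)

meeting : ∀ {n} → Subset n → ℕ → List (Subset n)
meeting []                    j       = []
meeting (_ ∷ F)               zero    = []
meeting {suc n} (inside  ∷ F) (suc j) = branch (subsets n j) (meeting F (suc j))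
meeting         (outside ∷ F) (suc j) = branch (meeting F j) (meeting F (suc j))

meeting-unique : ∀ {n} (F : Subset n) j → Unique (meeting F j)
meeting-unique []                    j       = []
meeting-unique (_ ∷ F)               zero    = []
meeting-unique {suc n} (inside  ∷ F) (suc j) = branch-unique (subsets-unique n j) (meeting-unique F (suc j))
meeting-unique         (outside ∷ F) (suc j) = branch-unique (meeting-unique F j) (meeting-unique F (suc j))

meeting-length : ∀ {n} (F : Subset n) j → length (meeting F j) + binom ∣ ∁ F ∣ j ≡ binom n j
meeting-length []                    zero    = refl
meeting-length []                    (suc j) = refl
meeting-length (_ ∷ F)               zero    = refl
meeting-length {suc n} (inside  ∷ F) (suc j) = begin
    length (branch (subsets n j) (meeting F (suc j))) + binom c (suc j)
      ≡⟨ cong (_+ binom c (suc j)) (branch-length (subsets n j) _) ⟩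
    (length (subsets n j) + length (meeting F (suc j))) + binom c (suc j)
      ≡⟨ +-assoc (length (subsets n j)) _ _ ⟩
    length (subsets n j) + (length (meeting F (suc j)) + binom c (suc j))
      ≡⟨ cong₂ _+_ (subsets-length n j) (meeting-length F (suc j)) ⟩
    binom n j + binom n (suc j) ∎
  where
  open ≡-Reasoning
  c = ∣ ∁ F ∣
meeting-length {suc n} (outside ∷ F) (suc j) = begin
    length (branch (meeting F j) (meeting F (suc j))) + (binom c j + binom c (suc j))
      ≡⟨ cong (_+ (binom c j + binom c (suc j))) (branch-length (meeting F j) _) ⟩
    (length (meeting F j) + length (meeting F (suc j))) + (binom c j + binom c (suc j))
      ≡⟨ +-+-interchange (length (meeting F j)) _ _ _ ⟩
    (length (meeting F j) + binom c j) + (length (meeting F (suc j)) + binom c (suc j))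
      ≡⟨ cong₂ _+_ (meeting-length F j) (meeting-length F (suc j)) ⟩
    binom n j + binom n (suc j) ∎
  where
  open ≡-Reasoning
  c = ∣ ∁ F ∣
  +-+-interchange : ∀ w x y z → (w + x) + (y + z) ≡ (w + y) + (x + z)
  +-+-interchange = solve-∀

meeting-sound : ∀ {n} (F : Subset n) j {s} → s ∈ meeting F j → ∣ s ∣ ≡ j × Meets F s
meeting-sound {suc n} (inside ∷ F) (suc j) p with branch-cases {xs = subsets n j} p
... | inj₁ (s , refl , s∈) = cong suc (subsets-sound s∈) , zero , here , here
... | inj₂ (s , refl , s∈) with ∣s∣ , meets ← meeting-sound F (suc j) s∈ = ∣s∣ , meets-there meets
meeting-sound (outside ∷ F) (suc j) p with branch-cases {xs = meeting F j} p
... | inj₁ (s , refl , s∈) with ∣s∣ , meets ← meeting-sound F j s∈ = cong suc ∣s∣ , meets-there meets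
... | inj₂ (s , refl , s∈) with ∣s∣ , meets ← meeting-sound F (suc j) s∈ = ∣s∣ , meets-there meets

meeting-complete : ∀ {n} (F : Subset n) {s j} → ∣ s ∣ ≡ j → Meets F s → s ∈ meeting F j
meeting-complete F {s} {zero} ∣s∣≡0 (v , _ , v∈s) with () ← ≤-trans (member⇒size≥1 v∈s) (≤-reflexive ∣s∣≡0)
meeting-complete (inside ∷ F) {inside ∷ s} {suc j} ∣s∣ _ =
  branch-inside (subsets-complete s (suc-injective ∣s∣))
meeting-complete (inside  ∷ F) {outside ∷ s} {suc j} ∣s∣ (suc v , there v∈F , there v∈s) =
  branch-outside (meeting-complete F ∣s∣ (v , v∈F , v∈s))
meeting-complete (outside ∷ F) {inside  ∷ s} {suc j} ∣s∣ (suc v , there v∈F , there v∈s) =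
  branch-inside (meeting-complete F (suc-injective ∣s∣) (v , v∈F , v∈s))
meeting-complete (outside ∷ F) {outside ∷ s} {suc j} ∣s∣ (suc v , there v∈F , there v∈s) =
  branch-outside (meeting-complete F ∣s∣ (v , v∈F , v∈s))

Covers : ∀ {n} → ℕ → Subset n → List (Subset n) → Set
Covers r F M = All (λ s → ∣ s ∣ ≡ r) M × (∀ {v} → v ∈ₛ F → Any (v ∈ₛ_) M)

-- Greedy covering: a nonempty F ⊆ Fin n is covered by ⌈|F|/r⌉ r-sets, i.e. by
-- m sets with r·m ≤ |F| + r - 1 (peel off r elements of F at a time; the last
-- ≤ r elements are padded to an r-set).
cover : ∀ {n} b → suc b ≤ n → (F : Subset n) → 1 ≤ ∣ F ∣
  → Σ (List (Subset n)) (λ M → Covers (suc b) F M × suc b * length M ≤ ∣ F ∣ + b)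
cover {n} b r≤n F 1≤∣F∣ = go ∣ F ∣ F ≤-refl 1≤∣F∣
  where
  r = suc b
  CoverOf : Subset n → Set
  CoverOf F = Σ (List (Subset n)) (λ M → Covers r F M × r * length M ≤ ∣ F ∣ + b)

  peeled-size : ∀ {F T} → T ⊆ F → ∣ T ∣ ≡ r → ∣ F ─ T ∣ + r ≡ ∣ F ∣
  peeled-size {F} {T} T⊆F ∣T∣ = trans (cong (∣ F ─ T ∣ +_) (sym ∣T∣)) (∣F─T∣+∣T∣≡∣F∣ F T T⊆F)

  add-block : ∀ {F T} → T ⊆ F → ∣ T ∣ ≡ r → CoverOf (F ─ T) → CoverOf F
  add-block {F} {T} T⊆F ∣T∣ (M , (sized , covers) , bound)
    with s , ∣s∣ , T⊆s ← superset-of-size T r (≤-reflexive ∣T∣) r≤n =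
    s ∷ M , (∣s∣ ∷ sized , covers′) , bound′
    where
    covers′ : ∀ {v} → v ∈ₛ F → Any (v ∈ₛ_) (s ∷ M)
    covers′ v∈F with ∈-─-split F T v∈F
    ... | inj₁ v∈T   = here (T⊆s v∈T)
    ... | inj₂ v∈F─T = there (covers v∈F─T)
    bound′ : r * suc (length M) ≤ ∣ F ∣ + b
    bound′ = begin
        r * suc (length M)  ≡⟨ *-suc r (length M) ⟩
        r + r * length M    ≤⟨ +-monoʳ-≤ r bound ⟩
        r + (∣ F ─ T ∣ + b) ≡⟨ sym (+-assoc r _ b) ⟩
        r + ∣ F ─ T ∣ + b   ≡⟨ cong (_+ b) (trans (+-comm r _) (peeled-size T⊆F ∣T∣)) ⟩
        ∣ F ∣ + b           ∎
      where open ≤-Reasoning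

  go : ∀ fuel (F : Subset n) → ∣ F ∣ ≤ fuel → 1 ≤ ∣ F ∣ → CoverOf F
  go fuel F ∣F∣≤fuel 1≤∣F∣ with ∣ F ∣ ≤? r
  ... | yes ∣F∣≤r with s , ∣s∣ , F⊆s ← superset-of-size F r ∣F∣≤r r≤n =
    [ s ] , ((∣s∣ ∷ []) , (λ v∈F → here (F⊆s v∈F))) ,
    ≤-trans (≤-reflexive (*-identityʳ r)) (+-monoˡ-≤ b 1≤∣F∣)
  go zero       F ∣F∣≤0    1≤∣F∣ | no _ = ⊥-elim (<⇒≱ 1≤∣F∣ ∣F∣≤0)
  go (suc fuel) F ∣F∣≤fuel _     | no ∣F∣≰r
    with T , T⊆F , ∣T∣ ← subset-of-size F r (<⇒≤ (≰⇒> ∣F∣≰r)) =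
    add-block T⊆F ∣T∣ (go fuel (F ─ T) rest≤fuel 1≤rest)
    where
    rest : ∣ F ─ T ∣ + r ≡ ∣ F ∣
    rest = peeled-size T⊆F ∣T∣
    rest≤fuel : ∣ F ─ T ∣ ≤ fuel
    rest≤fuel = +-cancelʳ-≤ r ∣ F ─ T ∣ fuel (begin
        ∣ F ─ T ∣ + r ≡⟨ rest ⟩
        ∣ F ∣         ≤⟨ ∣F∣≤fuel ⟩
        suc fuel      ≡⟨ +-comm 1 fuel ⟩
        fuel + 1      ≤⟨ +-monoʳ-≤ fuel (s≤s z≤n) ⟩
        fuel + r      ∎)
      where open ≤-Reasoning
    1≤rest : 1 ≤ ∣ F ─ T ∣
    1≤rest = +-cancelʳ-≤ r 1 ∣ F ─ T ∣ (≤-trans (≰⇒> ∣F∣≰r) (≤-reflexive (sym rest)))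

_≟ₛ_ : ∀ {n} → DecidableEquality (Subset n)
_≟ₛ_ = ≡-dec Bool._≟_

module _ {k r : ℕ} where
  open DecMembership (_≟ₛ_ {k}) using () renaming (_∈?_ to _∈ₗ?_; _∉?_ to _∉ₗ?_)

  edge-size : ∀ (H : Hypergraph k r) {s} → s ∈ E H → ∣ s ∣ ≡ r
  edge-size H = All.lookup (uniform H)

  incident : Hypergraph k r → Fin k → List (Subset k)
  incident H v = filter (v ∈?_) (E H)

  incident-unique : ∀ H v → Unique (incident H v)
  incident-unique H v = filter⁺ (v ∈?_) (unique H)

  incident-sound : ∀ H v {s} → s ∈ incident H v → ∣ s ∣ ≡ r × v ∈ₛ s
  incident-sound H v s∈ with s∈E , v∈s ← ∈-filter⁻ (v ∈?_) {xs = E H} s∈ = edge-size H s∈E , v∈s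

  ⊑⇒deg≤ : ∀ (H G : Hypergraph k r) → H ⊑ G → ∀ v → deg H v ≤ deg G v
  ⊑⇒deg≤ H G H⊑G v = unique-length-≤ (incident-unique H v) λ s∈ →
    let s∈E , v∈s = ∈-filter⁻ (v ∈?_) {xs = E H} s∈ in ∈-filter⁺ (v ∈?_) (H⊑G _ s∈E) v∈s

  Δ≤ : ∀ (H : Hypergraph k r) {c} → (∀ v → deg H v ≤ c) → Δ H ≤ c
  Δ≤ H {c} deg≤c = foldr-preservesᵇ {P = _≤ c} ⊔-lub z≤n (All.map⁺ (All.universal deg≤c (allFin k)))

  _∖_ : Hypergraph k r → List (Subset k) → Hypergraph k r
  G ∖ M = record
    { E       = filter (_∉ₗ? M) (E G)
    ; unique  = filter⁺ (_∉ₗ? M) (unique G)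
    ; uniform = All.tabulate (λ s∈ → edge-size G (proj₁ (∈-filter⁻ (_∉ₗ? M) s∈)))
    }

  ∖-⊑ : ∀ G M → (G ∖ M) ⊑ G
  ∖-⊑ G M _ s∈ = proj₁ (∈-filter⁻ (_∉ₗ? M) s∈)

  ∖-deletes : ∀ G {M s} → s ∈ M → s ∉ E (G ∖ M)
  ∖-deletes G {M} s∈M s∈ = proj₂ (∈-filter⁻ (_∉ₗ? M) {xs = E G} s∈) s∈M

  ∖-size : ∀ G M → numEdges G ≤ numEdges (G ∖ M) + length M
  ∖-size G M = begin
      length (E G)             ≤⟨ unique-length-≤ (unique G) kept-or-deleted ⟩
      length (E (G ∖ M) ++ M)  ≡⟨ length-++ (E (G ∖ M)) ⟩
      numEdges (G ∖ M) + length M ∎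
    where
    open ≤-Reasoning
    kept-or-deleted : ∀ {s} → s ∈ E G → s ∈ E (G ∖ M) ++ M
    kept-or-deleted {s} s∈E with s ∈ₗ? M
    ... | yes s∈M = ∈-++⁺ʳ (E (G ∖ M)) s∈M
    ... | no  s∉M = ∈-++⁺ˡ (∈-filter⁺ (_∉ₗ? M) s∈E s∉M)

  iso-by-identity : ∀ (G : Hypergraph k r) {P : Subset k → Set} → (∀ e → e ∈ E G ⇔ P e) → IsoTo G P
  iso-by-identity G {P} same = Permutation.id , λ e → subst (λ x → e ∈ _ ⇔ P x) (sym (tabulate∘lookup e)) (same e)

-- From now on k = K+1 and r = b+1, and D = C(k-1,r-1) = binom K b, the number of
-- r-subsets of Fin k through a given vertex.
module Degrees (K b : ℕ) where
  private
    k = suc K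
    r = suc b
  open DecMembership (_≟ₛ_ {k}) using () renaming (_∈?_ to _∈ₗ?_)

  D : ℕ
  D = binom K b

  -- The r-sets through v are the r-sets meeting {v}; there are C(k,r) - C(k-1,r) = D.
  through-count : ∀ v → length (meeting ⁅ v ⁆ r) ≡ D
  through-count v = +-cancelʳ-≡ (binom K r) _ _ (subst (λ c → length (meeting ⁅ v ⁆ r) + binom c r ≡ binom k r)
    ∣∁⁅v⁆∣≡K (meeting-length ⁅ v ⁆ r))
    where
    ∣∁⁅v⁆∣≡K : ∣ ∁ ⁅ v ⁆ ∣ ≡ K
    ∣∁⁅v⁆∣≡K = +-cancelʳ-≡ 1 _ _ (trans (cong (∣ ∁ ⁅ v ⁆ ∣ +_) (sym (∣⁅x⁆∣≡1 v))) (trans (∣∁p∣+∣p∣≡n ⁅ v ⁆) (+-comm 1 K)))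

  through-bound : ∀ v {L} → Unique L → (∀ {s} → s ∈ L → ∣ s ∣ ≡ r × v ∈ₛ s) → length L ≤ D
  through-bound v {L} uniq through = subst (length L ≤_) (through-count v) (unique-length-≤ uniq λ s∈ →
    let ∣s∣ , v∈s = through s∈ in meeting-complete ⁅ v ⁆ ∣s∣ (v , x∈⁅x⁆ v , v∈s))

  deg≤D : ∀ (H : Hypergraph k r) v → deg H v ≤ D
  deg≤D H v = through-bound v (incident-unique H v) (incident-sound H v)

  missing⇒deg<D : ∀ (H : Hypergraph k r) v {s} → ∣ s ∣ ≡ r → v ∈ₛ s → s ∉ E H → deg H v < D
  missing⇒deg<D H v {s} ∣s∣ v∈s s∉E = through-bound v (s∉incident ∷ incident-unique H v) through
    where
    s∉incident : All (λ t → ¬ s ≡ t) (incident H v)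
    s∉incident = All.tabulate λ t∈ s≡t → s∉E (subst (_∈ E H) (sym s≡t) (proj₁ (∈-filter⁻ (v ∈?_) {xs = E H} t∈)))
    through : ∀ {t} → t ∈ s ∷ incident H v → ∣ t ∣ ≡ r × v ∈ₛ t
    through (here refl) = ∣s∣ , v∈s
    through (there t∈)  = incident-sound H v t∈

  full⇒edges : ∀ (H : Hypergraph k r) v → deg H v ≡ D → ∀ s → ∣ s ∣ ≡ r → v ∈ₛ s → s ∈ E H
  full⇒edges H v degD s ∣s∣ v∈s with s ∈ₗ? E H
  ... | yes s∈E = s∈E
  ... | no  s∉E = ⊥-elim (<-irrefl degD (missing⇒deg<D H v ∣s∣ v∈s s∉E))

GoodSubgraph : ∀ {k r} → Hypergraph k r → ℕ → Set
GoodSubgraph {k} {r} G D =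
  Σ (Hypergraph k r) (λ G' → G' ⊑ G × (D ∸ 1) * numEdges G < D * numEdges G' × Δ G' ≤ D ∸ 1)

remaining-fraction : ∀ {D n n′ m} → 1 ≤ D → D * m < n → n ≤ n′ + m → (D ∸ 1) * n < D * n′
remaining-fraction {suc d} {n} {n′} {m} _ Dm<n n≤n′+m = +-cancelˡ-< n (d * n) (suc d * n′) (begin-strict
    suc d * n              ≤⟨ *-monoʳ-≤ (suc d) n≤n′+m ⟩
    suc d * (n′ + m)       ≡⟨ *-distribˡ-+ (suc d) n′ m ⟩
    suc d * n′ + suc d * m <⟨ +-monoʳ-< (suc d * n′) Dm<n ⟩
    suc d * n′ + n         ≡⟨ +-comm (suc d * n′) n ⟩
    n + suc d * n′         ∎)
  where open ≤-Reasoning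

module FullVertices (K b : ℕ) (G : Hypergraph (suc K) (suc b)) where
  open Degrees K b
  private
    k = suc K
    r = suc b

  F : Subset k
  F = tabulate (λ v → does (deg G v ≟ D))

  F⇒full : ∀ {v} → v ∈ₛ F → deg G v ≡ D
  F⇒full {v} v∈F = does⇒ (deg G v ≟ D) (trans (sym (lookup∘tabulate (λ v → does (deg G v ≟ D)) v)) ([]=⇒lookup v∈F))
    where
    does⇒ : ∀ {P : Set} (P? : Dec P) → does P? ≡ Bool.true → P
    does⇒ (yes p) _ = p

  full⇒F : ∀ {v} → deg G v ≡ D → v ∈ₛ F
  full⇒F {v} full = lookup⇒[]= v F (trans (lookup∘tabulate (λ v → does (deg G v ≟ D)) v) (dec-true (deg G v ≟ D) full))

  delete-cover : b ≤ K → ∀ {M} → Covers r F M → D * length M < numEdges G → GoodSubgraph G D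
  delete-cover b≤K {M} (sized , covers) DM<E =
    G ∖ M , ∖-⊑ G M , remaining-fraction (binom-pos b≤K) DM<E (∖-size G M) , Δ≤ (G ∖ M) (λ v → <⇒≤pred (deg<D v))
    where
    deg<D : ∀ v → deg (G ∖ M) v < D
    deg<D v with deg G v ≟ D
    ... | yes full with s , s∈M , v∈s ← find (covers (full⇒F full)) =
      missing⇒deg<D (G ∖ M) v (All.lookup sized s∈M) v∈s (∖-deletes G s∈M)
    ... | no not-full = ≤-<-trans (⊑⇒deg≤ (G ∖ M) G (∖-⊑ G M) v) (≤∧≢⇒< (deg≤D G v) not-full)

  -- If fewer than r vertices are not full, every r-set meets F, so G = K^(r)_k.
  few-nonfull⇒complete : ∣ ∁ F ∣ < r → IsoTo G (KEdge k r)
  few-nonfull⇒complete few = iso-by-identity G λ e → mk⇔ (edge-size G) λ ∣e∣ →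
    let v , v∈F , v∈e = large⇒meets F e (subst (∣ ∁ F ∣ <_) (sym ∣e∣) few)
    in full⇒edges G v (F⇒full v∈F) e ∣e∣ v∈e

  -- A full vertex c lying in every edge would make G the star S^(r)_k centred at c;
  -- otherwise an edge avoiding c gives |E(G)| ≥ D + 1.
  full-vertex⇒D<edges : ∀ {c} → c ∈ₛ F → ¬ IsoTo G (SEdge r c) → D < numEdges G
  full-vertex⇒D<edges {c} c∈F not-star with any? (λ e → ¬? (c ∈? e)) (E G)
  ... | yes avoiding with e , e∈E , c∉e ← find avoiding =
    subst (_< numEdges G) (F⇒full c∈F) (unique-length-≤ (e∉incident ∷ incident-unique G c) ⊆E)
    where
    e∉incident : All (λ t → ¬ e ≡ t) (incident G c)
    e∉incident = All.tabulate λ t∈ e≡t → c∉e (subst (c ∈ₛ_) (sym e≡t) (proj₂ (∈-filter⁻ (c ∈?_) {xs = E G} t∈)))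
    ⊆E : ∀ {t} → t ∈ e ∷ incident G c → t ∈ E G
    ⊆E (here refl) = e∈E
    ⊆E (there t∈)  = proj₁ (∈-filter⁻ (c ∈?_) {xs = E G} t∈)
  ... | no none = ⊥-elim (not-star (iso-by-identity G λ e → mk⇔
        (λ e∈E → edge-size G e∈E , through-c e∈E)
        (λ (∣e∣ , c∈e) → full⇒edges G c (F⇒full c∈F) e ∣e∣ c∈e)))
    where
    through-c : ∀ {e} → e ∈ E G → c ∈ₛ e
    through-c {e} e∈E with c ∈? e
    ... | yes c∈e = c∈e
    ... | no  c∉e = ⊥-elim (none (lose e∈E c∉e))

  meeting-F≤edges : length (meeting F r) ≤ numEdges G
  meeting-F≤edges = unique-length-≤ (meeting-unique F r) λ s∈ →
    let ∣s∣ , v , v∈F , v∈s = meeting-sound F r s∈ in full⇒edges G v (F⇒full v∈F) _ ∣s∣ v∈s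

  cover-budget : 1 ≤ b → r ≤ ∣ ∁ F ∣ → ¬ Σ (Fin k) (λ c → IsoTo G (SEdge r c))
    → ∀ g → ∣ F ∣ ≡ suc g → ∀ {m} → r * m ≤ ∣ F ∣ + b → D * m < numEdges G
  cover-budget _ _ not-star zero ∣F∣≡1 {m} bound
    with c , c∈F ← size≥1⇒nonempty F (≤-reflexive (sym ∣F∣≡1)) = begin-strict
      D * m  ≤⟨ *-monoʳ-≤ D m≤1 ⟩
      D * 1  ≡⟨ *-identityʳ D ⟩
      D      <⟨ full-vertex⇒D<edges c∈F (λ iso → not-star (c , iso)) ⟩
      numEdges G ∎
    where
    open ≤-Reasoning
    m≤1 : m ≤ 1
    m≤1 = *-cancelˡ-≤ r (≤-trans bound (≤-reflexive (trans (cong (_+ b) ∣F∣≡1) (sym (*-identityʳ r)))))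
  cover-budget 1≤b r≤n _ (suc g) ∣F∣≡ {m} bound = begin-strict
      D * m                          ≡⟨ cong (λ x → binom x b * m) K≡n+g ⟩
      binom (n + suc g) b * m        <⟨ cover-count 1≤b r≤n (s≤s z≤n) count (subst (λ f → r * m ≤ f + b) ∣F∣≡ bound) ⟩
      length (meeting F r)           ≤⟨ meeting-F≤edges ⟩
      numEdges G                     ∎
    where
    open ≤-Reasoning
    n = ∣ ∁ F ∣
    n+f≡k : n + suc (suc g) ≡ suc K
    n+f≡k = subst (λ f → n + f ≡ suc K) ∣F∣≡ (∣∁p∣+∣p∣≡n F)
    K≡n+g : K ≡ n + suc g
    K≡n+g = suc-injective (trans (sym n+f≡k) (+-suc n (suc g)))
    count : length (meeting F r) + binom n r ≡ binom (suc (n + suc g)) r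
    count = subst (λ x → length (meeting F r) + binom n r ≡ binom (suc x) r) K≡n+g (meeting-length F r)

  theorem : 1 ≤ b → b < K → 1 ≤ numEdges G → ¬ IsoTo G (KEdge k r)
    → ¬ Σ (Fin k) (λ c → IsoTo G (SEdge r c)) → GoodSubgraph G D
  theorem 1≤b b<K 1≤E not-complete not-star with ∣ ∁ F ∣ <? r
  ... | yes few = ⊥-elim (not-complete (few-nonfull⇒complete few))
  ... | no  r≤n with ∣ F ∣ in ∣F∣≡
  ...   | zero  = delete-cover (<⇒≤ b<K) {M = []} ([] , λ v∈F → no-full v∈F) (subst (_< numEdges G) (sym (*-zeroʳ D)) 1≤E)
    where
    no-full : ∀ {v} → v ∈ₛ F → Any (v ∈ₛ_) []
    no-full v∈F with () ← ≤-trans (member⇒size≥1 v∈F) (≤-reflexive ∣F∣≡)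
  ...   | suc g with M , covers , bound ← cover b (s≤s (<⇒≤ b<K)) F (≤-trans (s≤s z≤n) (≤-reflexive (sym ∣F∣≡))) =
    delete-cover (<⇒≤ b<K) covers (cover-budget 1≤b (≮⇒≥ r≤n) not-star g ∣F∣≡ bound)

lemma4p10 : (k r : ℕ) → 2 ≤ r → r < k → (G : Hypergraph k r)
    → 1 ≤ numEdges G
    → ¬ IsoTo G (KEdge k r)
    → ¬ Σ (Fin k) (λ c → IsoTo G (SEdge r c))
    → Σ (Hypergraph k r) (λ G' → G' ⊑ G
        × ((((k ∸ 1) C (r ∸ 1)) ∸ 1) * numEdges G < ((k ∸ 1) C (r ∸ 1)) * numEdges G')
        × Δ G' ≤ ((k ∸ 1) C (r ∸ 1)) ∸ 1)
lemma4p10 (suc K) (suc b) (s≤s 1≤b) (s≤s b<K) G 1≤E not-complete not-star =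
  subst (GoodSubgraph G) (binom≡C K b) (FullVertices.theorem K b G 1≤b b<K 1≤E not-complete not-star)
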